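{- For a clause $C$ of width $w$, the inequality $-M(C)\ge0$ has a derivation in Sherali-Adams resolution (SAR) of rank $w+1$ and size $O(w^2)$ from the inequality $S(C)-1\ge0$.
   Context: Variables are $x_1,\dots,x_n$ and twins $\bar x_1,\dots,\bar x_n$, treated as independent real variables. For disjoint sets of variables $Y,Z$ let $S(Y,Z)=\sum_{y\in Y}y+\sum_{z\in Z}\bar z$ and $M(Y,Z)=\prod_{y\in Y}\bar y\prod_{z\in Z}z$. For a clause $C=\bigvee_{y\in V^+}y\lor\bigvee_{z\in V^- }\bar z$ (with $V^+$, $V^-$ the variables occurring positively, resp. negatively), $S(C)=S(V^+,V^-)$ and $M(C)=M(V^+,V^-)$. Its width is the number of literals. An SAR derivation of $r\ge0$ from inequalities $q_1\ge0,\dots,q_m\ge0$ is an expression $\sum_{t=1}^{\tau}\alpha_t\prod_{i\in I_t}x_i\prod_{j\in J_t}(1-x_j)\,p_t$, where the products range over variables from $\{x_1,\dots,x_n,\bar x_1,\dots,\bar x_n\}$, $\alpha_t\ge0$ are reals, and each $p_t$ is one of the $q_j$, an axiom $x^2-x$ or $x-x^2$ (for any variable $x$ in this set), a complementarity axiom $1-x_i-\bar x_i$ or $-1+x_i+\bar x_i$, or the constant $1$, and which expands to $r$. Its rank is the maximum degree of the polynomials to which the summands $\prod_{i\in I_t}x_i\prod_{j\in J_t}(1-x_j)p_t$ expand, and its size is the sum of the numbers of terms of these polynomials. -}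

module Defs where

open import Data.Nat as ℕ using (ℕ; zero; suc; _⊔_)
open import Data.Fin using (Fin)
open import Data.Sum using (_⊎_; inj₁; inj₂)
open import Data.Product using (_×_; _,_; proj₁; proj₂)
import Data.Product.Properties as ×P
open import Data.Vec using (Vec; replicate; zipWith; updateAt)
import Data.Vec as V
import Data.Vec.Properties as VP
open import Data.List using (List; []; _∷_; map; foldr; length; filter; deduplicate; _++_; concatMap)
open import Data.List.Relation.Unary.Unique.Propositional using (Unique)
open import Data.List.Membership.Propositional using (_∈_; _∉_)
open import Data.Rational using (ℚ; 0ℚ; 1ℚ; _≤_; _≟_)
import Data.Rational as Q
open import Relation.Nullary using (¬?; Dec; yes; no)
open import Relation.Binary.Definitions using (DecidableEquality)
open import Relation.Binary.PropositionalEquality using (_≡_)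

-- Variables x₁..xₙ (inj₁ i) and their twins x̄₁..x̄ₙ (inj₂ i)

Var : ℕ → Set
Var n = Fin n ⊎ Fin n

-- Polynomials with rational coefficients in the 2n variables.
-- A monomial is its exponent vector (exponents of x's, exponents of x̄'s).

Mono : ℕ → Set
Mono n = Vec ℕ n × Vec ℕ n

_≟M_ : ∀ {n} → DecidableEquality (Mono n)
_≟M_ = ×P.≡-dec (VP.≡-dec ℕ._≟_) (VP.≡-dec ℕ._≟_)

unitM : ∀ {n} → Mono n
unitM = replicate _ 0 , replicate _ 0

varM : ∀ {n} → Var n → Mono n
varM (inj₁ i) = updateAt (replicate _ 0) i (λ _ → 1) , replicate _ 0
varM (inj₂ i) = replicate _ 0 , updateAt (replicate _ 0) i (λ _ → 1)

_*M_ : ∀ {n} → Mono n → Mono n → Mono n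
(a , b) *M (c , d) = zipWith ℕ._+_ a c , zipWith ℕ._+_ b d

degM : ∀ {n} → Mono n → ℕ
degM (a , b) = V.sum a ℕ.+ V.sum b

-- A polynomial is a (not necessarily normalised) list of terms;
-- its meaning is given by the coefficient function `coeff`.
Poly : ℕ → Set
Poly n = List (ℚ × Mono n)

constP : ∀ {n} → ℚ → Poly n
constP c = (c , unitM) ∷ []

varP : ∀ {n} → Var n → Poly n
varP v = (1ℚ , varM v) ∷ []

_+P_ : ∀ {n} → Poly n → Poly n → Poly n
p +P q = p ++ q

scaleP : ∀ {n} → ℚ → Poly n → Poly n
scaleP c p = map (λ t → (c Q.* proj₁ t , proj₂ t)) p

-P_ : ∀ {n} → Poly n → Poly n
-P p = scaleP (Q.- 1ℚ) p

_-P_ : ∀ {n} → Poly n → Poly n → Poly n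
p -P q = p +P (-P q)

_*P_ : ∀ {n} → Poly n → Poly n → Poly n
p *P q = concatMap (λ s → map (λ t → (proj₁ s Q.* proj₁ t , proj₂ s *M proj₂ t)) q) p

prodP : ∀ {n} → List (Poly n) → Poly n
prodP = foldr _*P_ (constP 1ℚ)

sumP : ∀ {n} → List (Poly n) → Poly n
sumP = foldr _+P_ []

coeff : ∀ {n} → Poly n → Mono n → ℚ
coeff [] m = 0ℚ
coeff ((c , m′) ∷ p) m with m′ ≟M m
... | yes _ = c Q.+ coeff p m
... | no  _ = coeff p m

_≈P_ : ∀ {n} → Poly n → Poly n → Set
p ≈P q = ∀ m → coeff p m ≡ coeff q m

support : ∀ {n} → Poly n → List (Mono n)
support p = filter (λ m → ¬? (coeff p m ≟ 0ℚ)) (deduplicate _≟M_ (map proj₂ p))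

nTerms : ∀ {n} → Poly n → ℕ
nTerms p = length (support p)

-- degree of the expanded polynomial (0 for the zero polynomial)
degP : ∀ {n} → Poly n → ℕ
degP p = foldr (λ m k → degM m ⊔ k) 0 (support p)

data Axiom (n : ℕ) (qs : List (Poly n)) : Set where
  hyp     : (q : Poly n) → q ∈ qs → Axiom n qs
  bool⁺   : Var n → Axiom n qs
  bool⁻   : Var n → Axiom n qs
  compl⁺  : Fin n → Axiom n qs
  compl⁻  : Fin n → Axiom n qs
  one     : Axiom n qs

axPoly : ∀ {n qs} → Axiom n qs → Poly n
axPoly (hyp q _)  = q
axPoly (bool⁺ v)  = (varP v *P varP v) -P varP v
axPoly (bool⁻ v)  = varP v -P (varP v *P varP v)
axPoly (compl⁺ i) = (constP 1ℚ -P varP (inj₁ i)) -P varP (inj₂ i)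
axPoly (compl⁻ i) = -P ((constP 1ℚ -P varP (inj₁ i)) -P varP (inj₂ i))
axPoly one        = constP 1ℚ

-- a summand α ∏_{i∈I} x_i ∏_{j∈J} (1 − x_j) p  (I, J sets of variables)
record Summand (n : ℕ) (qs : List (Poly n)) : Set where
  constructor summand
  field
    α     : ℚ
    α≥0   : 0ℚ ≤ α
    I     : List (Var n)
    I-set : Unique I
    J     : List (Var n)
    J-set : Unique J
    ax    : Axiom n qs

summandPoly : ∀ {n qs} → Summand n qs → Poly n
summandPoly s = (prodP (map varP I) *P prodP (map (λ v → constP 1ℚ -P varP v) J)) *P axPoly ax
  where open Summand s

-- an SAR derivation of r ≥ 0 from the inequalities qs ≥ 0
record SARDerivation (n : ℕ) (qs : List (Poly n)) (r : Poly n) : Set where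
  field
    summands : List (Summand n qs)
    expands  : sumP (map (λ s → scaleP (Summand.α s) (summandPoly s)) summands) ≈P r

rank : ∀ {n qs r} → SARDerivation n qs r → ℕ
rank d = foldr (λ s k → degP (summandPoly s) ⊔ k) 0 (SARDerivation.summands d)

size : ∀ {n qs r} → SARDerivation n qs r → ℕ
size d = foldr (λ s k → nTerms (summandPoly s) ℕ.+ k) 0 (SARDerivation.summands d)

-- Clauses  C = ⋁_{y∈V⁺} y ∨ ⋁_{z∈V⁻} ¬z  with V⁺, V⁻ disjoint sets of variables

record Clause (n : ℕ) : Set where
  field
    V⁺       : List (Fin n)
    V⁻       : List (Fin n)
    V⁺-set   : Unique V⁺
    V⁻-set   : Unique V⁻
    disjoint : ∀ {i} → i ∈ V⁺ → i ∉ V⁻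

width : ∀ {n} → Clause n → ℕ
width C = length (Clause.V⁺ C) ℕ.+ length (Clause.V⁻ C)

S : ∀ {n} → Clause n → Poly n
S C = sumP (map (λ i → varP (inj₁ i)) V⁺) +P sumP (map (λ i → varP (inj₂ i)) V⁻)
  where open Clause C

M : ∀ {n} → Clause n → Poly n
M C = prodP (map (λ i → varP (inj₂ i)) V⁺) *P prodP (map (λ i → varP (inj₁ i)) V⁻)
  where open Clause C

module Submission where

-- View each literal of C as a variable l (y for y ∈ V⁺, z̄ for z ∈ V⁻) with twin l̄,
-- so S(C) = Σ_l l and M(C) = X := ∏_l l̄.  The derivation is
--
--     X·(S(C) − 1)  +  Σ_l [ X·(1 − x_i − x̄_i)  +  (X / l̄)·(l̄² − l̄) ]   =   −X ,
--
-- i the index of l.  As monomials are exponent vectors, X = (X / l̄)·l̄, and the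
-- l-th bracket collapses to −X·l, cancelling the term X·l of X·S(C).  Every summand
-- is "product of distinct variables × axiom" of degree w + 1, and the 2w + 1
-- summands have w + 1, 3 and 2 terms, so the size is at most 6w + 1.

open import Defs
open import Data.Nat using (ℕ; _≤_; _+_; _*_; _^_)
open import Data.List using (_∷_; [])
open import Data.Product using (Σ; _×_)
open import Data.Rational using (1ℚ)

open import Data.Nat using (suc; _⊔_; z≤n; s≤s)
import Data.Nat.Properties as ℕP
import Data.Nat.Tactic.RingSolver as ℕSolver
open import Algebra.Properties.CommutativeSemigroup ℕP.+-commutativeSemigroup
  using () renaming (interchange to +-interchange)
open import Data.Rational as Q using (ℚ; 0ℚ)
import Data.Rational.Properties as QP
open import Data.Product using (_,_; proj₁; proj₂)
open import Data.Sum using (inj₁; inj₂)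
open import Data.Sum.Properties using (inj₁-injective; inj₂-injective)
open import Data.Fin as Fin using (Fin)
open import Data.Empty using (⊥)
open import Data.List using (List; _++_; map; foldr; length; deduplicate)
import Data.List.Properties as LP
open import Data.List.Relation.Unary.All as All using (All)
import Data.List.Relation.Unary.All.Properties as AllP
open import Data.List.Relation.Unary.Any using (here)
open import Data.List.Relation.Unary.Unique.Propositional using (Unique)
import Data.List.Relation.Unary.AllPairs as AllPairs
import Data.List.Relation.Unary.Unique.Propositional.Properties as UniqueP
open import Data.List.Membership.Propositional using (_∈_)
open import Data.List.Membership.Propositional.Properties
  using (∈-filter⁻; ∈-deduplicate⁻; ∈-map⁻)
open import Data.Vec as V using (Vec)
import Data.Vec.Properties as VP
open import Level using (0ℓ)
open import Relation.Nullary using (yes; no)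
open import Relation.Nullary.Decidable using (dec⇒maybe)
open import Relation.Binary.PropositionalEquality
import Tactic.RingSolver as RingSolver
import Tactic.RingSolver.Core.AlmostCommutativeRing as ACR

ℚ-ring : ACR.AlmostCommutativeRing 0ℓ 0ℓ
ℚ-ring = ACR.fromCommutativeRing QP.+-*-commutativeRing (λ x → dec⇒maybe (0ℚ Q.≟ x))

0≤1 : 0ℚ Q.≤ 1ℚ
0≤1 = QP.nonNegative⁻¹ 1ℚ

foldr-⊔-lub : ∀ {A : Set} (f : A → ℕ) {b : ℕ} (xs : List A) →
              All (λ x → f x ≤ b) xs → foldr (λ x k → f x ⊔ k) 0 xs ≤ b
foldr-⊔-lub f []       All.[]         = z≤n
foldr-⊔-lub f (x ∷ xs) (fx≤b All.∷ h) = ℕP.⊔-lub fx≤b (foldr-⊔-lub f xs h)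

Unique-drop-middle : ∀ {A : Set} (P : List A) {v : A} {R : List A} →
                     Unique (P ++ v ∷ R) → Unique (P ++ R)
Unique-drop-middle []      (_ AllPairs.∷ u)  = u
Unique-drop-middle (x ∷ P) (x∉ AllPairs.∷ u) = drop-All P x∉ AllPairs.∷ Unique-drop-middle P u
  where
  drop-All : ∀ {B : Set} {Pr : B → Set} (P : List B) {v : B} {R : List B} →
             All Pr (P ++ v ∷ R) → All Pr (P ++ R)
  drop-All []      (_ All.∷ h)  = h
  drop-All (y ∷ P) (py All.∷ h) = py All.∷ drop-All P h

length-middle : ∀ {A : Set} (P : List A) (v : A) (R : List A) →
                length (P ++ v ∷ R) ≡ suc (length (P ++ R))
length-middle []      v R = refl
length-middle (x ∷ P) v R = cong suc (length-middle P v R)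

sum-zipWith-+ : ∀ {k} (xs ys : Vec ℕ k) → V.sum (V.zipWith _+_ xs ys) ≡ V.sum xs + V.sum ys
sum-zipWith-+ V.[]       V.[]       = refl
sum-zipWith-+ (x V.∷ xs) (y V.∷ ys) =
  trans (cong (x + y +_) (sum-zipWith-+ xs ys)) (+-interchange x y (V.sum xs) (V.sum ys))

sum-zeros : ∀ k → V.sum (V.replicate k 0) ≡ 0
sum-zeros 0       = refl
sum-zeros (suc k) = sum-zeros k

sum-unitVector : ∀ {k} (i : Fin k) → V.sum (V.updateAt (V.replicate k 0) i (λ _ → 1)) ≡ 1
sum-unitVector {suc k} Fin.zero    = cong suc (sum-zeros k)
sum-unitVector {suc k} (Fin.suc i) = sum-unitVector i

module _ {n : ℕ} where

  δ : Mono n → Mono n → ℚ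
  δ a m = coeff ((1ℚ , a) ∷ []) m

  coeff-∷ : (c : ℚ) (a : Mono n) (p : Poly n) (m : Mono n) →
            coeff ((c , a) ∷ p) m ≡ c Q.* δ a m Q.+ coeff p m
  coeff-∷ c a p m with a ≟M m
  ... | yes _ = cong (Q._+ coeff p m) (sym (QP.*-identityʳ c))
  ... | no  _ = sym (trans (cong (Q._+ coeff p m) (QP.*-zeroʳ c)) (QP.+-identityˡ _))

  -- A coefficient is the weighted sum of the indicators of the terms; this turns
  -- identities between explicit polynomials into ring algebra over the δ's.
  coeff-expand : (p : Poly n) (m : Mono n) →
                 coeff p m ≡ foldr (λ t r → proj₁ t Q.* δ (proj₂ t) m Q.+ r) 0ℚ p
  coeff-expand []            m = refl
  coeff-expand ((c , a) ∷ p) m = trans (coeff-∷ c a p m) (cong (c Q.* δ a m Q.+_) (coeff-expand p m))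

  coeff-++ : (p q : Poly n) (m : Mono n) → coeff (p ++ q) m ≡ coeff p m Q.+ coeff q m
  coeff-++ []            q m = sym (QP.+-identityˡ _)
  coeff-++ ((c , a) ∷ p) q m = begin
    coeff ((c , a) ∷ p ++ q) m                   ≡⟨ coeff-∷ c a (p ++ q) m ⟩
    c Q.* δ a m Q.+ coeff (p ++ q) m              ≡⟨ cong (c Q.* δ a m Q.+_) (coeff-++ p q m) ⟩
    c Q.* δ a m Q.+ (coeff p m Q.+ coeff q m)     ≡⟨ QP.+-assoc (c Q.* δ a m) (coeff p m) (coeff q m) ⟨
    (c Q.* δ a m Q.+ coeff p m) Q.+ coeff q m     ≡⟨ cong (Q._+ coeff q m) (coeff-∷ c a p m) ⟨
    coeff ((c , a) ∷ p) m Q.+ coeff q m ∎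
    where open ≡-Reasoning

  coeff-scale : (c : ℚ) (p : Poly n) (m : Mono n) → coeff (scaleP c p) m ≡ c Q.* coeff p m
  coeff-scale c []            m = sym (QP.*-zeroʳ c)
  coeff-scale c ((d , a) ∷ p) m = begin
    coeff ((c Q.* d , a) ∷ scaleP c p) m           ≡⟨ coeff-∷ (c Q.* d) a (scaleP c p) m ⟩
    c Q.* d Q.* δ a m Q.+ coeff (scaleP c p) m     ≡⟨ cong₂ Q._+_ (QP.*-assoc c d _) (coeff-scale c p m) ⟩
    c Q.* (d Q.* δ a m) Q.+ c Q.* coeff p m        ≡⟨ QP.*-distribˡ-+ c _ _ ⟨
    c Q.* (d Q.* δ a m Q.+ coeff p m)              ≡⟨ cong (c Q.*_) (coeff-∷ d a p m) ⟨
    c Q.* coeff ((d , a) ∷ p) m ∎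
    where open ≡-Reasoning

  *M-assoc : (a b c : Mono n) → (a *M b) *M c ≡ a *M (b *M c)
  *M-assoc (a₁ , a₂) (b₁ , b₂) (c₁ , c₂) =
    cong₂ _,_ (VP.zipWith-assoc ℕP.+-assoc a₁ b₁ c₁) (VP.zipWith-assoc ℕP.+-assoc a₂ b₂ c₂)

  *M-comm : (a b : Mono n) → a *M b ≡ b *M a
  *M-comm (a₁ , a₂) (b₁ , b₂) =
    cong₂ _,_ (VP.zipWith-comm ℕP.+-comm a₁ b₁) (VP.zipWith-comm ℕP.+-comm a₂ b₂)

  *M-identityʳ : (a : Mono n) → a *M unitM ≡ a
  *M-identityʳ (a₁ , a₂) =
    cong₂ _,_ (VP.zipWith-identityʳ ℕP.+-identityʳ a₁) (VP.zipWith-identityʳ ℕP.+-identityʳ a₂)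

  *M-identityˡ : (a : Mono n) → unitM *M a ≡ a
  *M-identityˡ a = trans (*M-comm unitM a) (*M-identityʳ a)

  degM-*M : (a b : Mono n) → degM (a *M b) ≡ degM a + degM b
  degM-*M (a₁ , a₂) (b₁ , b₂) rewrite sum-zipWith-+ a₁ b₁ | sum-zipWith-+ a₂ b₂ =
    +-interchange (V.sum a₁) (V.sum b₁) (V.sum a₂) (V.sum b₂)

  degM-unitM : degM (unitM {n}) ≡ 0
  degM-unitM rewrite sum-zeros n = refl

  degM-varM : (v : Var n) → degM (varM v) ≡ 1
  degM-varM (inj₁ i) rewrite sum-unitVector i | sum-zeros n = refl
  degM-varM (inj₂ i) rewrite sum-unitVector i | sum-zeros n = refl

  monoOf : List (Var n) → Mono n
  monoOf []      = unitM
  monoOf (v ∷ I) = varM v *M monoOf I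

  prodP-vars : (I : List (Var n)) → prodP (map varP I) ≡ (1ℚ , monoOf I) ∷ []
  prodP-vars []      = refl
  prodP-vars (v ∷ I) rewrite prodP-vars I = refl

  degM-monoOf : (I : List (Var n)) → degM (monoOf I) ≡ length I
  degM-monoOf []      = degM-unitM
  degM-monoOf (v ∷ I) = trans (degM-*M (varM v) (monoOf I)) (cong₂ _+_ (degM-varM v) (degM-monoOf I))

  monoOf-++ : (P R : List (Var n)) → monoOf (P ++ R) ≡ monoOf P *M monoOf R
  monoOf-++ []      R = sym (*M-identityˡ (monoOf R))
  monoOf-++ (v ∷ P) R =
    trans (cong (varM v *M_) (monoOf-++ P R)) (sym (*M-assoc (varM v) (monoOf P) (monoOf R)))

  -- Since monomials are exponent vectors, inserting v anywhere in I multiplies by v.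
  monoOf-middle : (P R : List (Var n)) (v : Var n) → monoOf (P ++ R) *M varM v ≡ monoOf (P ++ v ∷ R)
  monoOf-middle P R v = begin
    monoOf (P ++ R) *M varM v           ≡⟨ cong (_*M varM v) (monoOf-++ P R) ⟩
    (monoOf P *M monoOf R) *M varM v    ≡⟨ *M-assoc (monoOf P) (monoOf R) (varM v) ⟩
    monoOf P *M (monoOf R *M varM v)    ≡⟨ cong (monoOf P *M_) (*M-comm (monoOf R) (varM v)) ⟩
    monoOf P *M monoOf (v ∷ R)          ≡⟨ monoOf-++ P (v ∷ R) ⟨
    monoOf (P ++ v ∷ R) ∎
    where open ≡-Reasoning

  DegreeAtMost : ℕ → Poly n → Set
  DegreeAtMost k p = All (λ t → degM (proj₂ t) ≤ k) p

  degP-≤ : ∀ {k} (p : Poly n) → DegreeAtMost k p → degP p ≤ k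
  degP-≤ p bound = foldr-⊔-lub degM (support p) (All.tabulate (λ m∈ →
    All.lookup (AllP.map⁺ bound) (∈-deduplicate⁻ _≟M_ (map proj₂ p) (proj₁ (∈-filter⁻ _ m∈)))))

  nTerms-≤ : (p : Poly n) → nTerms p ≤ length p
  nTerms-≤ p = begin
    nTerms p                                   ≤⟨ LP.length-filter _ (deduplicate _≟M_ (map proj₂ p)) ⟩
    length (deduplicate _≟M_ (map proj₂ p)) ≤⟨ LP.length-deduplicate _≟M_ (map proj₂ p) ⟩
    length (map proj₂ p)                       ≡⟨ LP.length-map proj₂ p ⟩
    length p ∎
    where open ℕP.≤-Reasoning

  varM≤1+ : ∀ {k} (v : Var n) → degM (varM v) ≤ suc k
  varM≤1+ v = ℕP.≤-trans (ℕP.≤-reflexive (degM-varM v)) (s≤s z≤n)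

  unitM≤ : ∀ {k} → degM (unitM {n}) ≤ k
  unitM≤ = ℕP.≤-trans (ℕP.≤-reflexive degM-unitM) z≤n

  sum-vars-degree : (ls : List (Var n)) → DegreeAtMost 1 (sumP (map varP ls))
  sum-vars-degree []       = All.[]
  sum-vars-degree (l ∷ ls) = varM≤1+ l All.∷ sum-vars-degree ls

  length-sum-vars : (ls : List (Var n)) → length (sumP (map varP ls)) ≡ length ls
  length-sum-vars []       = refl
  length-sum-vars (l ∷ ls) = cong suc (length-sum-vars ls)

  _·M_ : Mono n → Poly n → Poly n
  a ·M p = map (λ t → (proj₁ t , a *M proj₂ t)) p

  ·M-degree : ∀ {k} (a : Mono n) (p : Poly n) → DegreeAtMost k p → DegreeAtMost (degM a + k) (a ·M p)
  ·M-degree a p bound = AllP.map⁺ (All.map (λ {t} d≤k →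
    ℕP.≤-trans (ℕP.≤-reflexive (degM-*M a (proj₂ t))) (ℕP.+-monoʳ-≤ (degM a) d≤k)) bound)

  coeff-·M-vars-∷ : (X : Mono n) (l : Var n) (ls : List (Var n)) (m : Mono n) →
    coeff (X ·M sumP (map varP (l ∷ ls))) m ≡ δ (X *M varM l) m Q.+ coeff (X ·M sumP (map varP ls)) m
  coeff-·M-vars-∷ X l ls m = trans (coeff-∷ 1ℚ (X *M varM l) (X ·M sumP (map varP ls)) m)
                                   (cong (Q._+ coeff (X ·M sumP (map varP ls)) m) (QP.*-identityˡ (δ (X *M varM l) m)))

  -- A literal is the variable occurring in S(C); its twin is the other variable of
  -- the same index, i.e. the one occurring in M(C).
  twin : Var n → Var n
  twin (inj₁ i) = inj₂ i
  twin (inj₂ i) = inj₁ i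

  index : Var n → Fin n
  index (inj₁ i) = i
  index (inj₂ i) = i

  twin-pair : (f : Var n → ℚ) (l : Var n) →
              f (inj₁ (index l)) Q.+ f (inj₂ (index l)) ≡ f l Q.+ f (twin l)
  twin-pair f (inj₁ i) = refl
  twin-pair f (inj₂ i) = QP.+-comm (f (inj₁ i)) (f (inj₂ i))

module _ {n : ℕ} {qs : List (Poly n)} where

  unitSummand : (I : List (Var n)) → Unique I → Axiom n qs → Summand n qs
  unitSummand I U ax = summand 1ℚ 0≤1 I U [] AllPairs.[] ax

  summandPoly-unit : (I : List (Var n)) (U : Unique I) (ax : Axiom n qs) →
                     summandPoly (unitSummand I U ax) ≡ monoOf I ·M axPoly ax
  summandPoly-unit I U ax rewrite prodP-vars I =
    trans (LP.++-identityʳ _) (LP.map-cong (λ t → cong₂ _,_ (QP.*-identityˡ (proj₁ t))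
                                                          (cong (_*M proj₂ t) (*M-identityʳ (monoOf I))))
                                          (axPoly ax))

  contribution : Summand n qs → Poly n
  contribution s = scaleP (Summand.α s) (summandPoly s)

  combination : List (Summand n qs) → Poly n
  combination ss = sumP (map contribution ss)

  coeff-unitSummand : (I : List (Var n)) (U : Unique I) (ax : Axiom n qs) (m : Mono n) →
                      coeff (contribution (unitSummand I U ax)) m ≡ coeff (monoOf I ·M axPoly ax) m
  coeff-unitSummand I U ax m = begin
    coeff (scaleP 1ℚ p) m  ≡⟨ coeff-scale 1ℚ p m ⟩
    1ℚ Q.* coeff p m       ≡⟨ QP.*-identityˡ (coeff p m) ⟩
    coeff p m              ≡⟨ cong (λ q → coeff q m) (summandPoly-unit I U ax) ⟩
    coeff (monoOf I ·M axPoly ax) m ∎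
    where
    open ≡-Reasoning
    p = summandPoly (unitSummand I U ax)

  unitSummand-degree : ∀ {k} (I : List (Var n)) (U : Unique I) (ax : Axiom n qs) →
                       DegreeAtMost k (axPoly ax) → degP (summandPoly (unitSummand I U ax)) ≤ length I + k
  unitSummand-degree {k} I U ax bound =
    subst (λ p → degP p ≤ length I + k) (sym (summandPoly-unit I U ax))
      (degP-≤ (monoOf I ·M axPoly ax)
        (subst (λ d → DegreeAtMost (d + k) (monoOf I ·M axPoly ax)) (degM-monoOf I)
          (·M-degree (monoOf I) (axPoly ax) bound)))

  unitSummand-terms : (I : List (Var n)) (U : Unique I) (ax : Axiom n qs) →
                      nTerms (summandPoly (unitSummand I U ax)) ≤ length (axPoly ax)
  unitSummand-terms I U ax =
    subst (λ p → nTerms p ≤ length (axPoly ax)) (sym (summandPoly-unit I U ax))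
      (ℕP.≤-trans (nTerms-≤ (monoOf I ·M axPoly ax)) (ℕP.≤-reflexive (LP.length-map _ (axPoly ax))))

  coeff-compl : (X : Mono n) (i : Fin n) (m : Mono n) →
    coeff (X ·M axPoly {qs = qs} (compl⁺ i)) m
      ≡ δ X m Q.+ Q.- (δ (X *M varM (inj₁ i)) m Q.+ δ (X *M varM (inj₂ i)) m)
  coeff-compl X i m = trans (coeff-expand (X ·M axPoly {qs = qs} (compl⁺ i)) m)
    (trans (algebra (δ (X *M unitM) m) (δ (X *M xᵢ) m) (δ (X *M x̄ᵢ) m))
           (cong (λ a → δ a m Q.+ Q.- (δ (X *M xᵢ) m Q.+ δ (X *M x̄ᵢ) m)) (*M-identityʳ X)))
    where
    xᵢ = varM (inj₁ i)
    x̄ᵢ = varM (inj₂ i)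
    algebra : ∀ a b c → 1ℚ Q.* a Q.+ (Q.- 1ℚ Q.* 1ℚ Q.* b Q.+ (Q.- 1ℚ Q.* 1ℚ Q.* c Q.+ 0ℚ))
                          ≡ a Q.+ Q.- (b Q.+ c)
    algebra = RingSolver.solve-∀ ℚ-ring

  coeff-bool : (Y : Mono n) (v : Var n) (m : Mono n) →
    coeff (Y ·M axPoly {qs = qs} (bool⁺ v)) m ≡ δ (Y *M (varM v *M varM v)) m Q.+ Q.- δ (Y *M varM v) m
  coeff-bool Y v m = trans (coeff-expand (Y ·M axPoly {qs = qs} (bool⁺ v)) m)
                          (algebra (δ (Y *M (varM v *M varM v)) m) (δ (Y *M varM v) m))
    where
    algebra : ∀ a b → 1ℚ Q.* 1ℚ Q.* a Q.+ (Q.- 1ℚ Q.* 1ℚ Q.* b Q.+ 0ℚ) ≡ a Q.+ Q.- b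
    algebra = RingSolver.solve-∀ ℚ-ring

  -- The heart of the proof: for X = Y·l̄,
  --   X·(1 − x_i − x̄_i) + Y·(l̄² − l̄) = X − X·l − X·l̄ + X·l̄ − X = −X·l.
  literal-cancel : (X Y : Mono n) (l : Var n) → Y *M varM (twin l) ≡ X → (m : Mono n) →
    coeff (X ·M axPoly {qs = qs} (compl⁺ (index l))) m Q.+ coeff (Y ·M axPoly {qs = qs} (bool⁺ (twin l))) m
      ≡ Q.- δ (X *M varM l) m
  literal-cancel X Y l refl m = begin
    coeff (X ·M axPoly {qs = qs} (compl⁺ (index l))) m Q.+ coeff (Y ·M axPoly {qs = qs} (bool⁺ l̄)) m
      ≡⟨ cong₂ Q._+_ (coeff-compl X (index l) m) (coeff-bool Y l̄ m) ⟩
    δ X m Q.+ Q.- (δ (X *M varM (inj₁ (index l))) m Q.+ δ (X *M varM (inj₂ (index l))) m)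
      Q.+ (δ (Y *M (varM l̄ *M varM l̄)) m Q.+ Q.- δ X m)
      ≡⟨ cong₂ (λ a b → δ X m Q.+ Q.- a Q.+ (δ b m Q.+ Q.- δ X m))
               (twin-pair (λ v → δ (X *M varM v) m) l) (sym (*M-assoc Y (varM l̄) (varM l̄))) ⟩
    δ X m Q.+ Q.- (δ (X *M varM l) m Q.+ δ (X *M varM l̄) m) Q.+ (δ (X *M varM l̄) m Q.+ Q.- δ X m)
      ≡⟨ algebra (δ X m) (δ (X *M varM l) m) (δ (X *M varM l̄) m) ⟩
    Q.- δ (X *M varM l) m ∎
    where
    open ≡-Reasoning
    l̄ = twin l
    algebra : ∀ x a b → x Q.+ Q.- (a Q.+ b) Q.+ (b Q.+ Q.- x) ≡ Q.- a
    algebra = RingSolver.solve-∀ ℚ-ring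

  -- For the literals in `post`, P listing the twins of the literals already
  -- treated: the complementarity summand of l uses all twins P ++ map twin (l ∷ post),
  -- the Boolean summand the same twins without l̄.
  literalSummands : (P post : List (Var n)) → Unique (P ++ map twin post) → List (Summand n qs)
  literalSummands P []         U = []
  literalSummands P (l ∷ post) U =
      unitSummand (P ++ map twin (l ∷ post)) U (compl⁺ (index l))
    ∷ unitSummand (P ++ map twin post) (Unique-drop-middle P U) (bool⁺ (twin l))
    ∷ literalSummands (P ++ twin l ∷ []) post (subst Unique (sym (LP.++-assoc P _ _)) U)

  combination-literalSummands : (P post : List (Var n)) (U : Unique (P ++ map twin post)) (m : Mono n) →
    coeff (combination (literalSummands P post U)) m
      ≡ Q.- coeff (monoOf (P ++ map twin post) ·M sumP (map varP post)) m
  combination-literalSummands P []         U m = refl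
  combination-literalSummands P (l ∷ post) U m = begin
    coeff (contribution compl ++ (contribution bool ++ rest)) m
      ≡⟨ trans (coeff-++ (contribution compl) _ m)
               (cong (coeff (contribution compl) m Q.+_) (coeff-++ (contribution bool) rest m)) ⟩
    coeff (contribution compl) m Q.+ (coeff (contribution bool) m Q.+ coeff rest m)
      ≡⟨ QP.+-assoc (coeff (contribution compl) m) (coeff (contribution bool) m) (coeff rest m) ⟨
    coeff (contribution compl) m Q.+ coeff (contribution bool) m Q.+ coeff rest m
      ≡⟨ cong₂ (λ a b → a Q.+ b Q.+ coeff rest m)
               (coeff-unitSummand (P ++ map twin (l ∷ post)) U (compl⁺ (index l)) m)
               (coeff-unitSummand (P ++ map twin post) (Unique-drop-middle P U) (bool⁺ (twin l)) m) ⟩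
    coeff (X ·M axPoly {qs = qs} (compl⁺ (index l))) m Q.+ coeff (Y ·M axPoly {qs = qs} (bool⁺ (twin l))) m
      Q.+ coeff rest m
      ≡⟨ cong₂ Q._+_ (literal-cancel X Y l (monoOf-middle P (map twin post) (twin l)) m)
                     (trans (combination-literalSummands (P ++ twin l ∷ []) post _ m)
                            (cong (λ Z → Q.- coeff (monoOf Z ·M sumP (map varP post)) m) (LP.++-assoc P _ _))) ⟩
    Q.- δ (X *M varM l) m Q.+ Q.- coeff (X ·M sumP (map varP post)) m
      ≡⟨ QP.neg-distrib-+ (δ (X *M varM l) m) (coeff (X ·M sumP (map varP post)) m) ⟨
    Q.- (δ (X *M varM l) m Q.+ coeff (X ·M sumP (map varP post)) m)
      ≡⟨ cong Q.-_ (coeff-·M-vars-∷ X l post m) ⟨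
    Q.- coeff (X ·M sumP (map varP (l ∷ post))) m ∎
    where
    open ≡-Reasoning
    X = monoOf (P ++ map twin (l ∷ post))
    Y = monoOf (P ++ map twin post)
    compl = unitSummand (P ++ map twin (l ∷ post)) U (compl⁺ (index l))
    bool = unitSummand (P ++ map twin post) (Unique-drop-middle P U) (bool⁺ (twin l))
    rest = combination (literalSummands (P ++ twin l ∷ []) post (subst Unique (sym (LP.++-assoc P _ _)) U))

  -- Each of them is a product of at most |P ++ map twin post| variables with a
  -- quadratic axiom, or of all of them with a linear one.
  literalSummands-degree : (P post : List (Var n)) (U : Unique (P ++ map twin post)) →
    All (λ s → degP (summandPoly s) ≤ length (P ++ map twin post) + 1) (literalSummands P post U)
  literalSummands-degree P []         U = All.[]
  literalSummands-degree P (l ∷ post) U =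
      unitSummand-degree _ U (compl⁺ (index l)) compl-degree
    All.∷ ℕP.≤-trans (unitSummand-degree _ (Unique-drop-middle P U) (bool⁺ (twin l)) bool-degree)
                     (ℕP.≤-reflexive (trans (ℕP.+-suc _ 1) (cong (_+ 1) (sym (length-middle P (twin l) _)))))
    All.∷ All.map (λ d≤ → ℕP.≤-trans d≤ (ℕP.≤-reflexive (cong (λ Z → length Z + 1) (LP.++-assoc P _ _))))
                  (literalSummands-degree (P ++ twin l ∷ []) post _)
    where
    compl-degree : DegreeAtMost 1 (axPoly {qs = qs} (compl⁺ (index l)))
    compl-degree = unitM≤ {n} All.∷ varM≤1+ (inj₁ (index l)) All.∷ varM≤1+ (inj₂ (index l)) All.∷ All.[]
    bool-degree : DegreeAtMost 2 (axPoly {qs = qs} (bool⁺ (twin l)))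
    bool-degree = ℕP.≤-reflexive (trans (degM-*M (varM (twin l)) (varM (twin l)))
                                        (cong₂ _+_ (degM-varM (twin l)) (degM-varM (twin l))))
                  All.∷ varM≤1+ (twin l) All.∷ All.[]

  sizeOf : List (Summand n qs) → ℕ
  sizeOf ss = foldr (λ s k → nTerms (summandPoly s) + k) 0 ss

  -- Each literal costs 3 + 2 terms.
  literalSummands-size : (P post : List (Var n)) (U : Unique (P ++ map twin post)) →
                         sizeOf (literalSummands P post U) ≤ 5 * length post
  literalSummands-size P []         U = z≤n
  literalSummands-size P (l ∷ post) U = ℕP.≤-trans
    (ℕP.+-mono-≤ (unitSummand-terms _ U (compl⁺ (index l)))
      (ℕP.+-mono-≤ (unitSummand-terms _ (Unique-drop-middle P U) (bool⁺ (twin l)))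
        (literalSummands-size (P ++ twin l ∷ []) post _)))
    (ℕP.≤-reflexive (arithmetic (length post)))
    where
    arithmetic : ∀ k → 3 + (2 + 5 * k) ≡ 5 * suc k
    arithmetic = ℕSolver.solve-∀

BoundedDerivation : ∀ {n} → Poly n → Poly n → ℕ → ℕ → Set
BoundedDerivation {n} q r ρ σ = Σ (SARDerivation n (q ∷ []) r) (λ d → (rank d ≤ ρ) × (size d ≤ σ))

literalsHyp : ∀ {n} → List (Var n) → Poly n
literalsHyp ls = sumP (map varP ls) -P constP 1ℚ

size-arithmetic : ∀ w → (w + 1) + 5 * w ≤ 6 * (w + 1) ^ 2
size-arithmetic w = ℕP.≤-trans (ℕP.m≤m+n _ (6 * w * w + 6 * w + 5)) (ℕP.≤-reflexive (expand w))
  where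
  -- (w + 1) ^ 2 unfolds to (w + 1) * ((w + 1) * 1), a form the solver accepts
  expand : ∀ w → (w + 1) + 5 * w + (6 * w * w + 6 * w + 5) ≡ 6 * ((w + 1) * ((w + 1) * 1))
  expand = ℕSolver.solve-∀

module _ {n : ℕ} (ls : List (Var n)) (U : Unique (map twin ls)) where

  twinProduct : Mono n
  twinProduct = monoOf (map twin ls)

  hypAxiom : Axiom n (literalsHyp ls ∷ [])
  hypAxiom = hyp (literalsHyp ls) (here refl)

  hypSummand : Summand n (literalsHyp ls ∷ [])
  hypSummand = unitSummand (map twin ls) U hypAxiom

  literalsSummands : List (Summand n (literalsHyp ls ∷ []))
  literalsSummands = hypSummand ∷ literalSummands [] ls U

  -- X·(Σ l − 1) − X·Σ l = −X
  literalsSummands-expand : combination literalsSummands ≈P (-P ((1ℚ , twinProduct) ∷ []))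
  literalsSummands-expand m = begin
    coeff (contribution hypSummand ++ combination (literalSummands [] ls U)) m
      ≡⟨ coeff-++ (contribution hypSummand) _ m ⟩
    coeff (contribution hypSummand) m Q.+ coeff (combination (literalSummands [] ls U)) m
      ≡⟨ cong₂ Q._+_ (coeff-unitSummand (map twin ls) U hypAxiom m) (combination-literalSummands [] ls U m) ⟩
    coeff (twinProduct ·M (Σls ++ -P constP 1ℚ)) m Q.+ Q.- coeff (twinProduct ·M Σls) m
      ≡⟨ cong (λ p → coeff p m Q.+ Q.- coeff (twinProduct ·M Σls) m) (LP.map-++ _ Σls _) ⟩
    coeff (twinProduct ·M Σls ++ twinProduct ·M (-P constP 1ℚ)) m Q.+ Q.- coeff (twinProduct ·M Σls) m
      ≡⟨ cong (Q._+ Q.- coeff (twinProduct ·M Σls) m) (coeff-++ (twinProduct ·M Σls) _ m) ⟩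
    coeff (twinProduct ·M Σls) m Q.+ coeff (twinProduct ·M (-P constP 1ℚ)) m Q.+ Q.- coeff (twinProduct ·M Σls) m
      ≡⟨ algebra (coeff (twinProduct ·M Σls) m) (coeff (twinProduct ·M (-P constP 1ℚ)) m) ⟩
    coeff (twinProduct ·M (-P constP 1ℚ)) m
      ≡⟨ cong (λ a → coeff ((Q.- 1ℚ Q.* 1ℚ , a) ∷ []) m) (*M-identityʳ twinProduct) ⟩
    coeff (-P ((1ℚ , twinProduct) ∷ [])) m ∎
    where
    open ≡-Reasoning
    Σls = sumP (map varP ls)
    algebra : ∀ s c → s Q.+ c Q.+ Q.- s ≡ c
    algebra = RingSolver.solve-∀ ℚ-ring

  literalsSummands-degree : All (λ s → degP (summandPoly s) ≤ length ls + 1) literalsSummands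
  literalsSummands-degree = All.map (λ d≤ → ℕP.≤-trans d≤ (ℕP.≤-reflexive length-twins))
    (unitSummand-degree (map twin ls) U hypAxiom hyp-degree All.∷ literalSummands-degree [] ls U)
    where
    length-twins : length (map twin ls) + 1 ≡ length ls + 1
    length-twins = cong (_+ 1) (LP.length-map twin ls)
    hyp-degree : DegreeAtMost 1 (literalsHyp ls)
    hyp-degree = AllP.++⁺ (sum-vars-degree ls) (unitM≤ {n} All.∷ All.[])

  literalsSummands-size : sizeOf literalsSummands ≤ (length ls + 1) + 5 * length ls
  literalsSummands-size =
    ℕP.+-mono-≤ (ℕP.≤-trans (unitSummand-terms (map twin ls) U hypAxiom) (ℕP.≤-reflexive hyp-length))
                (literalSummands-size [] ls U)
    where
    hyp-length : length (literalsHyp ls) ≡ length ls + 1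
    hyp-length = trans (LP.length-++ (sumP (map varP ls))) (cong (_+ 1) (length-sum-vars ls))

  literalsDerivation : BoundedDerivation (literalsHyp ls) (-P ((1ℚ , twinProduct) ∷ []))
                                         (length ls + 1) (6 * (length ls + 1) ^ 2)
  literalsDerivation =
      record { summands = literalsSummands ; expands = literalsSummands-expand }
    , foldr-⊔-lub (λ s → degP (summandPoly s)) literalsSummands literalsSummands-degree
    , ℕP.≤-trans literalsSummands-size (size-arithmetic (length ls))

module _ {n : ℕ} (C : Clause n) where
  open Clause C

  literals : List (Var n)
  literals = map inj₁ V⁺ ++ map inj₂ V⁻

  twins-literals : map twin literals ≡ map inj₂ V⁺ ++ map inj₁ V⁻
  twins-literals = trans (LP.map-++ twin (map inj₁ V⁺) (map inj₂ V⁻))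
                         (sym (cong₂ _++_ (LP.map-∘ V⁺) (LP.map-∘ V⁻)))

  -- The twins ȳ (y ∈ V⁺) and z (z ∈ V⁻) are distinct: they come from the
  -- duplicate-free V⁺, V⁻ and lie on different sides of Var n.
  unique-twins : Unique (map twin literals)
  unique-twins = subst (λ (xs : List (Var n)) → Unique xs) (sym twins-literals) unique-split
    where
    sides : ∀ {v} → v ∈ map inj₂ V⁺ × v ∈ map inj₁ V⁻ → ⊥
    sides (v∈⁺ , v∈⁻) with ∈-map⁻ inj₂ v∈⁺ | ∈-map⁻ inj₁ v∈⁻
    ... | _ , _ , refl | _ , _ , ()
    unique-split : Unique (map inj₂ V⁺ ++ map inj₁ V⁻)
    unique-split = UniqueP.++⁺ (UniqueP.map⁺ inj₂-injective V⁺-set) (UniqueP.map⁺ inj₁-injective V⁻-set)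
                               sides

  width-literals : length literals ≡ width C
  width-literals = trans (LP.length-++ (map inj₁ V⁺))
                         (cong₂ _+_ (LP.length-map inj₁ V⁺) (LP.length-map inj₂ V⁻))

  S-literals : S C -P constP 1ℚ ≡ literalsHyp literals
  S-literals = cong (_-P constP 1ℚ) (begin
    sumP (map (λ i → varP (inj₁ i)) V⁺) ++ sumP (map (λ i → varP (inj₂ i)) V⁻)
      ≡⟨ cong₂ (λ a b → sumP a ++ sumP b) (LP.map-∘ V⁺) (LP.map-∘ V⁻) ⟩
    sumP (map varP (map inj₁ V⁺)) ++ sumP (map varP (map inj₂ V⁻))
      ≡⟨ LP.concat-++ (map varP (map inj₁ V⁺)) _ ⟩
    sumP (map varP (map inj₁ V⁺) ++ map varP (map inj₂ V⁻))
      ≡⟨ cong sumP (LP.map-++ varP (map inj₁ V⁺) _) ⟨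
    sumP (map varP literals) ∎)
    where open ≡-Reasoning

  M-literals : M C ≡ (1ℚ , monoOf (map twin literals)) ∷ []
  M-literals = begin
    prodP (map (λ i → varP (inj₂ i)) V⁺) *P prodP (map (λ i → varP (inj₁ i)) V⁻)
      ≡⟨ cong₂ (λ a b → prodP a *P prodP b) (LP.map-∘ V⁺) (LP.map-∘ V⁻) ⟩
    prodP (map varP (map inj₂ V⁺)) *P prodP (map varP (map inj₁ V⁻))
      ≡⟨ cong₂ _*P_ (prodP-vars (map inj₂ V⁺)) (prodP-vars (map inj₁ V⁻)) ⟩
    (1ℚ , monoOf (map inj₂ V⁺) *M monoOf (map inj₁ V⁻)) ∷ []
      ≡⟨ cong (λ a → (1ℚ , a) ∷ []) (sym (monoOf-++ (map inj₂ V⁺) _)) ⟩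
    (1ℚ , monoOf (map inj₂ V⁺ ++ map inj₁ V⁻)) ∷ []
      ≡⟨ cong (λ I → (1ℚ , monoOf I) ∷ []) twins-literals ⟨
    (1ℚ , monoOf (map twin literals)) ∷ [] ∎
    where open ≡-Reasoning

  clauseDerivation : BoundedDerivation (S C -P constP 1ℚ) (-P M C) (width C + 1) (6 * (width C + 1) ^ 2)
  clauseDerivation =
    subst (λ w → BoundedDerivation (S C -P constP 1ℚ) (-P M C) (w + 1) (6 * (w + 1) ^ 2)) width-literals
      (subst₂ (λ q r → BoundedDerivation q (-P r) (length literals + 1) (6 * (length literals + 1) ^ 2))
              (sym S-literals) (sym M-literals)
              (literalsDerivation literals unique-twins))

lemma4p2 : Σ ℕ (λ c → ∀ (n : ℕ) (C : Clause n) →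
             Σ (SARDerivation n ((S C -P constP 1ℚ) ∷ []) (-P M C)) (λ d →
               (rank d ≤ width C + 1) × (size d ≤ c * (width C + 1) ^ 2)))
lemma4p2 = 6 , λ n C → clauseDerivation C
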